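{- For $X\in\{0,1\}^\omega$ the following are equivalent: (1) $X$ is martingale $\mathrm{BP}$ random. (2) There do not exist a primitive recursive martingale $d$ and a primitive recursive function $f$ such that, for every $n$, there exists $m\le f(n)$ with $d(X\upharpoonright m)\ge 2^n$. (3) There do not exist a primitive recursive martingale $d$ and a primitive recursive function $f$ such that $d(X\upharpoonright m)\ge 2^n$ for all $n$ and all $m\ge f(n)$.
   Context: $X\upharpoonright m$ is the length-$m$ initial segment of $X\in\{0,1\}^\omega$. A martingale is a function $d:\{0,1\}^*\to\mathbb Q\cap[0,\infty)$ with $d(\emptyset)=1$ and $d(\sigma)=(d(\sigma0)+d(\sigma1))/2$ for all $\sigma$. A martingale $d$ succeeds primitive recursively on $X$ if there is a primitive recursive $f$ with $d(X\upharpoonright f(n))\ge 2^n$ for all $n$. $X$ is martingale $\mathrm{BP}$ random if no primitive recursive martingale succeeds primitive recursively on $X$. -}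

module Defs where

open import Data.Nat using (ℕ; zero; suc; _+_; _*_; _^_)
open import Data.Fin using (Fin)
open import Data.Vec using (Vec; []; _∷_; lookup; map)
open import Data.Bool using (Bool; true; false)
open import Data.List using (List; []; _∷_; _++_; [_])
open import Data.Integer using (+_)
open import Data.Rational using (ℚ; _/_; 0ℚ; 1ℚ; ½) renaming (_+_ to _+ℚ_; _*_ to _*ℚ_; _≤_ to _≤ℚ_)
open import Data.Product using (Σ; _×_)
open import Relation.Binary.PropositionalEquality using (_≡_)

data PR : ℕ → Set where
  pzero : PR 0
  psucc : PR 1
  pproj : ∀ {k} → Fin k → PR k
  pcomp : ∀ {k m} → PR m → Vec (PR k) m → PR k
  prec  : ∀ {k} → PR k → PR (suc (suc k)) → PR (suc k)

mutual
  eval : ∀ {k} → PR k → Vec ℕ k → ℕ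
  eval pzero xs = 0
  eval psucc (x ∷ []) = suc x
  eval (pproj i) xs = lookup xs i
  eval (pcomp g hs) xs = eval g (evalAll hs xs)
  eval (prec g s) (zero ∷ xs) = eval g xs
  eval (prec g s) (suc n ∷ xs) = eval s (eval (prec g s) (n ∷ xs) ∷ n ∷ xs)

  evalAll : ∀ {k m} → Vec (PR k) m → Vec ℕ k → Vec ℕ m
  evalAll [] xs = []
  evalAll (h ∷ hs) xs = eval h xs ∷ evalAll hs xs

PrimRec : (ℕ → ℕ) → Set
PrimRec f = Σ (PR 1) λ c → ∀ x → eval c (x ∷ []) ≡ f x

-- Binary strings {0,1}* as List Bool (false = 0, true = 1),
-- the string σb is σ ++ [ b ].

-- Standard bijective coding of {0,1}* by ℕ (length-lexicographic):
-- code ε = 0, code (σb) = 2·code σ + 1 + b.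
bit : Bool → ℕ
bit false = 0
bit true  = 1

codeAux : ℕ → List Bool → ℕ
codeAux acc [] = acc
codeAux acc (b ∷ σ) = codeAux (2 * acc + 1 + bit b) σ

code : List Bool → ℕ
code σ = codeAux 0 σ

PrimRecQ : (List Bool → ℚ) → Set
PrimRecQ d = Σ (ℕ → ℕ) λ p → Σ (ℕ → ℕ) λ q →
  PrimRec p × PrimRec q × (∀ σ → d σ ≡ (+ p (code σ)) / suc (q (code σ)))

IsMartingale : (List Bool → ℚ) → Set
IsMartingale d = (∀ σ → 0ℚ ≤ℚ d σ) × (d [] ≡ 1ℚ) ×
  (∀ σ → d σ ≡ (d (σ ++ [ false ]) +ℚ d (σ ++ [ true ])) *ℚ ½)

PRMartingale : (List Bool → ℚ) → Set
PRMartingale d = IsMartingale d × PrimRecQ d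

Seq : Set
Seq = ℕ → Bool

_↾_ : Seq → ℕ → List Bool
X ↾ zero = []
X ↾ suc m = (X ↾ m) ++ [ X m ]

pow2 : ℕ → ℚ
pow2 n = (+ (2 ^ n)) / 1

open import Data.Nat using (_≤_)
open import Relation.Nullary using (¬_)

MartingaleBPRandom : Seq → Set
MartingaleBPRandom X = ¬ (Σ (List Bool → ℚ) λ d → Σ (ℕ → ℕ) λ f →
  PRMartingale d × PrimRec f × (∀ n → pow2 n ≤ℚ d (X ↾ f n)))

Cond2 : Seq → Set
Cond2 X = ¬ (Σ (List Bool → ℚ) λ d → Σ (ℕ → ℕ) λ f →
  PRMartingale d × PrimRec f ×
  (∀ n → Σ ℕ λ m → m ≤ f n × pow2 n ≤ℚ d (X ↾ m)))

Cond3 : Seq → Set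
Cond3 X = ¬ (Σ (List Bool → ℚ) λ d → Σ (ℕ → ℕ) λ f →
  PRMartingale d × PrimRec f ×
  (∀ n m → f n ≤ m → pow2 n ≤ℚ d (X ↾ m)))

module Submission where

-- Success at f(n) gives success within f(n), and success from f(n) on gives success at
-- f(n); the content is that success within f(n) yields success from a primitive recursive
-- bound on. This is the savings trick: along a path, the new martingale stakes only d/2^K,
-- where K is the highest level d has reached so far (level t meaning d ≥ 2^(2t−1)), and
-- banks the rest. Banked capital is never lost, and once level K is reached the bank holds
-- at least (2^K − 1)/2. So if d(X↾m) ≥ 2^(2n+3) for some m ≤ f(2n+3), the new martingale
-- is at least 2^n on every X↾m′ with m′ > f(2n+3). Its value on a string is computed from
-- the code of the string by primitive recursion over the codes of the prefixes, and all
-- rational arithmetic is reduced to cross-multiplied identities between natural numbers.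

open import Data.Bool using (Bool; true; false)
open import Data.Fin using (Fin; #_)
open import Data.Integer as ℤ using (+_; +≤+)
import Data.Integer.Properties as ℤ
open import Data.List using (List; []; _∷_; _++_; [_])
open import Data.Nat using (ℕ; zero; suc; _+_; _*_; _∸_; _^_; _≤_; _<_; z≤n; s≤s; pred; NonZero; ⌊_/2⌋; ⌈_/2⌉)
open import Data.Nat.Properties
open import Data.Nat.Tactic.RingSolver using (solve-∀)
open import Data.Product using (Σ; _,_; _×_; proj₁; proj₂)
open import Data.Rational as ℚ using (ℚ; toℚᵘ; ½)
open import Data.Rational.Properties
  using (toℚᵘ-injective; toℚᵘ-cong; toℚᵘ-fromℚᵘ; toℚᵘ-homo-+; toℚᵘ-homo-*; fromℚᵘ-cong; fromℚᵘ-injective; toℚᵘ-cancel-≤; toℚᵘ-mono-≤)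
open import Data.Rational.Unnormalised as ℚᵘ using (ℚᵘ; mkℚᵘ; *≡*; *≤*; _≃_; ↥_; ↧_)
import Data.Rational.Unnormalised.Properties as ℚᵘ
open import Data.Sum using (inj₁; inj₂)
open import Data.Vec using (Vec; []; _∷_; lookup; head; tail)
open import Data.Vec.N-ary using (N-ary; _$ⁿ_)
open import Function.Bundles using (_⇔_; mk⇔; Equivalence)
open import Relation.Binary.PropositionalEquality hiding ([_])
open import Relation.Nullary using (contradiction)

open import Defs

-- Fractions p/(q+1)

IsAverage : ℕ → ℕ → ℕ → ℕ → ℕ → ℕ → Set
IsAverage n d n₀ d₀ n₁ d₁ = n * (d₀ * d₁ * 2) ≡ (n₀ * d₁ + n₁ * d₀) * d

isAverage-resp-denominators : ∀ {n D n₀ D₀ n₁ D₁ D′ D₀′ D₁′} → D′ ≡ D → D₀′ ≡ D₀ → D₁′ ≡ D₁ →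
  IsAverage n D n₀ D₀ n₁ D₁ → IsAverage n D′ n₀ D₀′ n₁ D₁′
isAverage-resp-denominators refl refl refl avg = avg

_/1+_ : ℕ → ℕ → ℚ
a /1+ b = + a ℚ./ suc b

frac : ℕ → ℕ → ℚᵘ
frac a b = mkℚᵘ (+ a) b

≃-frac : ∀ a b r {n m} → ↥ r ≡ + n → ↧ r ≡ + m → frac a b ≃ r ⇔ a * m ≡ n * suc b
≃-frac a b r {n} {m} ↥r ↧r = mk⇔
  (λ { (*≡* eq) → ℤ.+-injective (begin
       + (a * m)              ≡⟨ ℤ.pos-* a m ⟩
       + a ℤ.* + m            ≡⟨ cong (+ a ℤ.*_) (sym ↧r) ⟩
       + a ℤ.* ↧ r            ≡⟨ eq ⟩
       ↥ r ℤ.* + suc b        ≡⟨ cong (ℤ._* + suc b) ↥r ⟩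
       + n ℤ.* + suc b        ≡⟨ ℤ.pos-* n (suc b) ⟨
       + (n * suc b)          ∎) })
  (λ eq → *≡* (begin
       + a ℤ.* ↧ r            ≡⟨ cong (+ a ℤ.*_) ↧r ⟩
       + a ℤ.* + m            ≡⟨ ℤ.pos-* a m ⟨
       + (a * m)              ≡⟨ cong +_ eq ⟩
       + (n * suc b)          ≡⟨ ℤ.pos-* n (suc b) ⟩
       + n ℤ.* + suc b        ≡⟨ cong (ℤ._* + suc b) ↥r ⟨
       ↥ r ℤ.* + suc b        ∎))
  where open ≡-Reasoning

≤-frac : ∀ a b c d → frac a b ℚᵘ.≤ frac c d ⇔ a * suc d ≤ c * suc b
≤-frac a b c d = mk⇔
  (λ { (*≤* le) → ℤ.drop‿+≤+ (subst₂ ℤ._≤_ (sym (ℤ.pos-* a (suc d))) (sym (ℤ.pos-* c (suc b))) le) })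
  (λ le → *≤* (subst₂ ℤ._≤_ (ℤ.pos-* a (suc d)) (ℤ.pos-* c (suc b)) (+≤+ le)))

toℚᵘ-/1+ : ∀ a b → toℚᵘ (a /1+ b) ≃ frac a b
toℚᵘ-/1+ a b = toℚᵘ-fromℚᵘ (frac a b)

/1+-≡ : ∀ a b c d → a /1+ b ≡ c /1+ d ⇔ a * suc d ≡ c * suc b
/1+-≡ a b c d = mk⇔
  (λ eq → Equivalence.to frac≃ (fromℚᵘ-injective eq))
  (λ eq → fromℚᵘ-cong (Equivalence.from frac≃ eq))
  where
  frac≃ : frac a b ≃ frac c d ⇔ a * suc d ≡ c * suc b
  frac≃ = ≃-frac a b (frac c d) refl refl

/1+-≤ : ∀ a b c d → a /1+ b ℚ.≤ c /1+ d ⇔ a * suc d ≤ c * suc b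
/1+-≤ a b c d = mk⇔
  (λ le → Equivalence.to (≤-frac a b c d)
    (ℚᵘ.≤-respʳ-≃ (toℚᵘ-/1+ c d) (ℚᵘ.≤-respˡ-≃ (toℚᵘ-/1+ a b) (toℚᵘ-mono-≤ le))))
  (λ le → toℚᵘ-cancel-≤ (ℚᵘ.≤-respʳ-≃ (ℚᵘ.≃-sym (toℚᵘ-/1+ c d))
    (ℚᵘ.≤-respˡ-≃ (ℚᵘ.≃-sym (toℚᵘ-/1+ a b)) (Equivalence.from (≤-frac a b c d) le))))

/1+-average : ∀ a e b e₀ c e₁ →
  a /1+ e ≡ (b /1+ e₀ ℚ.+ c /1+ e₁) ℚ.* ½ ⇔ IsAverage a (suc e) b (suc e₀) c (suc e₁)
/1+-average a e b e₀ c e₁ = mk⇔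
  (λ eq → Equivalence.to frac≃avg (ℚᵘ.≃-trans (ℚᵘ.≃-sym (toℚᵘ-/1+ a e)) (ℚᵘ.≃-trans (toℚᵘ-cong eq) toℚᵘ-avg)))
  (λ eq → toℚᵘ-injective (ℚᵘ.≃-trans (toℚᵘ-/1+ a e)
    (ℚᵘ.≃-trans (Equivalence.from frac≃avg eq) (ℚᵘ.≃-sym toℚᵘ-avg))))
  where
  avg : ℚᵘ
  avg = (frac b e₀ ℚᵘ.+ frac c e₁) ℚᵘ.* ℚᵘ.½
  toℚᵘ-avg : toℚᵘ ((b /1+ e₀ ℚ.+ c /1+ e₁) ℚ.* ½) ≃ avg
  toℚᵘ-avg = ℚᵘ.≃-trans (toℚᵘ-homo-* (b /1+ e₀ ℚ.+ c /1+ e₁) ½)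
    (ℚᵘ.*-congʳ {ℚᵘ.½} (ℚᵘ.≃-trans (toℚᵘ-homo-+ (b /1+ e₀) (c /1+ e₁)) (ℚᵘ.+-cong (toℚᵘ-/1+ b e₀) (toℚᵘ-/1+ c e₁))))
  ↥avg : ↥ avg ≡ + (b * suc e₁ + c * suc e₀)
  ↥avg = begin
    (+ b ℤ.* + suc e₁ ℤ.+ + c ℤ.* + suc e₀) ℤ.* + 1 ≡⟨ ℤ.*-identityʳ _ ⟩
    + b ℤ.* + suc e₁ ℤ.+ + c ℤ.* + suc e₀           ≡⟨ cong₂ ℤ._+_ (ℤ.pos-* b (suc e₁)) (ℤ.pos-* c (suc e₀)) ⟨
    + (b * suc e₁ + c * suc e₀)                     ∎
    where open ≡-Reasoning
  frac≃avg : frac a e ≃ avg ⇔ IsAverage a (suc e) b (suc e₀) c (suc e₁)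
  frac≃avg = ≃-frac a e avg ↥avg refl

-- Primitive recursive functions

IsPR : (k : ℕ) → (Vec ℕ k → ℕ) → Set
IsPR k f = Σ (PR k) λ c → ∀ xs → eval c xs ≡ f xs

IsPRⁿ : (k : ℕ) → N-ary k ℕ ℕ → Set
IsPRⁿ k f = IsPR k (f $ⁿ_)

isPR⇒primRec : ∀ {f} → IsPRⁿ 1 f → PrimRec f
isPR⇒primRec (c , e) = c , λ x → e (x ∷ [])

primRec⇒isPR : ∀ {f} → PrimRec f → IsPRⁿ 1 f
primRec⇒isPR (c , e) = c , λ { (x ∷ []) → e x }

pr-ext : ∀ {k f g} → IsPR k f → (∀ xs → f xs ≡ g xs) → IsPR k g
pr-ext (c , e) f≗g = c , λ xs → trans (e xs) (f≗g xs)

pr-proj : ∀ {k} (i : Fin k) → IsPR k (λ xs → lookup xs i)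
pr-proj i = pproj i , λ _ → refl

pr-∘₁ : ∀ {k g f} → IsPRⁿ 1 g → IsPR k f → IsPR k (λ xs → g (f xs))
pr-∘₁ {f = f} (cg , eg) (cf , ef) = pcomp cg (cf ∷ []) ,
  λ xs → trans (cong (λ x → eval cg (x ∷ [])) (ef xs)) (eg (f xs ∷ []))

pr-∘₂ : ∀ {k g f₁ f₂} → IsPRⁿ 2 g → IsPR k f₁ → IsPR k f₂ → IsPR k (λ xs → g (f₁ xs) (f₂ xs))
pr-∘₂ {f₁ = f₁} {f₂} (cg , eg) (c₁ , e₁) (c₂ , e₂) = pcomp cg (c₁ ∷ c₂ ∷ []) ,
  λ xs → trans (cong₂ (λ x y → eval cg (x ∷ y ∷ [])) (e₁ xs) (e₂ xs)) (eg (f₁ xs ∷ f₂ xs ∷ []))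

pr-∘₃ : ∀ {k g f₁ f₂ f₃} → IsPRⁿ 3 g → IsPR k f₁ → IsPR k f₂ → IsPR k f₃ →
        IsPR k (λ xs → g (f₁ xs) (f₂ xs) (f₃ xs))
pr-∘₃ {f₁ = f₁} {f₂} {f₃} (cg , eg) (c₁ , e₁) (c₂ , e₂) (c₃ , e₃) = pcomp cg (c₁ ∷ c₂ ∷ c₃ ∷ []) ,
  λ xs → trans (cong₃ (e₁ xs) (e₂ xs) (e₃ xs)) (eg (f₁ xs ∷ f₂ xs ∷ f₃ xs ∷ []))
  where
  cong₃ : ∀ {x x′ y y′ z z′} → x ≡ x′ → y ≡ y′ → z ≡ z′ → eval cg (x ∷ y ∷ z ∷ []) ≡ eval cg (x′ ∷ y′ ∷ z′ ∷ [])
  cong₃ refl refl refl = refl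

pr-rec : ∀ {k s} (h : ℕ → Vec ℕ k → ℕ) → IsPR k (h 0) → IsPR (suc (suc k)) s →
         (∀ n xs → h (suc n) xs ≡ s (h n xs ∷ n ∷ xs)) → IsPR (suc k) (λ xs → h (head xs) (tail xs))
pr-rec {s = s} h (cg , eg) (cs , es) h-suc = prec cg cs , go
  where
  go : ∀ xs → eval (prec cg cs) xs ≡ h (head xs) (tail xs)
  go (zero  ∷ xs) = eg xs
  go (suc n ∷ xs) = begin
    eval cs (eval (prec cg cs) (n ∷ xs) ∷ n ∷ xs) ≡⟨ cong (λ r → eval cs (r ∷ n ∷ xs)) (go (n ∷ xs)) ⟩
    eval cs (h n xs ∷ n ∷ xs)                     ≡⟨ es _ ⟩
    s (h n xs ∷ n ∷ xs)                           ≡⟨ h-suc n xs ⟨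
    h (suc n) xs                                  ∎
    where open ≡-Reasoning

pr-suc : IsPRⁿ 1 suc
pr-suc = psucc , λ { (x ∷ []) → refl }

pr-const : ∀ {k} n → IsPR k (λ _ → n)
pr-const zero    = pcomp pzero [] , λ _ → refl
pr-const (suc n) = pr-∘₁ pr-suc (pr-const n)

pr-rec₁ : ∀ {s} (h : ℕ → ℕ) → IsPR 2 s → (∀ n → h (suc n) ≡ s (h n ∷ n ∷ [])) → IsPRⁿ 1 h
pr-rec₁ h pr-s h-suc = pr-ext (pr-rec (λ n _ → h n) (pr-const (h 0)) pr-s λ { n [] → h-suc n })
  λ { (n ∷ []) → refl }

pr-rec₂ : ∀ {g s} (h : ℕ → ℕ → ℕ) → IsPR 1 g → IsPR 3 s →
          (∀ x → h 0 x ≡ g (x ∷ [])) → (∀ n x → h (suc n) x ≡ s (h n x ∷ n ∷ x ∷ [])) → IsPRⁿ 2 h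
pr-rec₂ h pr-g pr-s h-zero h-suc =
  pr-ext (pr-rec (λ n xs → h n $ⁿ xs) (pr-ext pr-g λ { (x ∷ []) → sym (h-zero x) }) pr-s
                 λ { n (x ∷ []) → h-suc n x })
    λ { (n ∷ x ∷ []) → refl }

pr-rec₃ : ∀ {g s} (h : ℕ → ℕ → ℕ → ℕ) → IsPR 2 g → IsPR 4 s →
          (∀ x y → h 0 x y ≡ g (x ∷ y ∷ [])) → (∀ n x y → h (suc n) x y ≡ s (h n x y ∷ n ∷ x ∷ y ∷ [])) →
          IsPRⁿ 3 h
pr-rec₃ h pr-g pr-s h-zero h-suc =
  pr-ext (pr-rec (λ n xs → h n $ⁿ xs) (pr-ext pr-g λ { (x ∷ y ∷ []) → sym (h-zero x y) }) pr-s
                 λ { n (x ∷ y ∷ []) → h-suc n x y })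
    λ { (n ∷ x ∷ y ∷ []) → refl }

pr-+ : IsPRⁿ 2 _+_
pr-+ = pr-rec₂ _+_ (pr-proj (# 0)) (pr-∘₁ pr-suc (pr-proj (# 0))) (λ _ → refl) λ _ _ → refl

pr-* : IsPRⁿ 2 _*_
pr-* = pr-rec₂ _*_ (pr-const 0) (pr-∘₂ pr-+ (pr-proj (# 2)) (pr-proj (# 0))) (λ _ → refl) λ _ _ → refl

pr-pred : IsPRⁿ 1 pred
pr-pred = pr-rec₁ pred (pr-proj (# 1)) λ _ → refl

pr-∸ : IsPRⁿ 2 _∸_
pr-∸ = pr-ext (pr-∘₂ pr-flipped-∸ (pr-proj (# 1)) (pr-proj (# 0))) λ { (m ∷ n ∷ []) → refl }
  where
  pr-flipped-∸ : IsPRⁿ 2 (λ n m → m ∸ n)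
  pr-flipped-∸ = pr-rec₂ (λ n m → m ∸ n) (pr-proj (# 0)) (pr-∘₁ pr-pred (pr-proj (# 0)))
    (λ _ → refl) λ n m → sym (pred[m∸n]≡m∸[1+n] m n)

pr-2^ : IsPRⁿ 1 (2 ^_)
pr-2^ = pr-rec₁ (2 ^_) (pr-∘₂ pr-+ (pr-proj (# 0)) (pr-∘₂ pr-+ (pr-proj (# 0)) (pr-const 0))) λ _ → refl

ifZero : ℕ → ℕ → ℕ → ℕ
ifZero zero    x y = x
ifZero (suc _) x y = y

pr-ifZero : IsPRⁿ 3 ifZero
pr-ifZero = pr-rec₃ ifZero (pr-proj (# 0)) (pr-proj (# 3)) (λ _ _ → refl) λ _ _ _ → refl

-- Codes of binary strings

child : ℕ → Bool → ℕ
child c b = 2 * c + 1 + bit b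

codeAux-snoc : ∀ acc σ b → codeAux acc (σ ++ [ b ]) ≡ child (codeAux acc σ) b
codeAux-snoc acc []      b = refl
codeAux-snoc acc (x ∷ σ) b = codeAux-snoc (2 * acc + 1 + bit x) σ b

code-snoc : ∀ σ b → code (σ ++ [ b ]) ≡ child (code σ) b
code-snoc = codeAux-snoc 0

child≡suc : ∀ c b → child c b ≡ suc (bit b + (c + c))
child≡suc c b = rearrange c (bit b)
  where
  rearrange : ∀ c x → 2 * c + 1 + x ≡ suc (x + (c + c))
  rearrange = solve-∀

parent : ℕ → ℕ
parent c = ⌊ pred c /2⌋

parent-child : ∀ c b → parent (child c b) ≡ c
parent-child c false = trans (cong (λ n → ⌊ pred n /2⌋) (child≡suc c false)) (sym (n≡⌊n+n/2⌋ c))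
parent-child c true  = trans (cong (λ n → ⌊ pred n /2⌋) (child≡suc c true))  (sym (n≡⌈n+n/2⌉ c))

parent-≤ : ∀ c → parent c ≤ pred c
parent-≤ c = ⌊n/2⌋≤n (pred c)

⌊suc/2⌋≡∸⌊/2⌋ : ∀ n → ⌊ suc n /2⌋ ≡ n ∸ ⌊ n /2⌋
⌊suc/2⌋≡∸⌊/2⌋ n = begin
  ⌈ n /2⌉                     ≡⟨ m+n∸m≡n ⌊ n /2⌋ ⌈ n /2⌉ ⟨
  ⌊ n /2⌋ + ⌈ n /2⌉ ∸ ⌊ n /2⌋ ≡⟨ cong (_∸ ⌊ n /2⌋) (⌊n/2⌋+⌈n/2⌉≡n n) ⟩
  n ∸ ⌊ n /2⌋                 ∎
  where open ≡-Reasoning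

pr-⌊/2⌋ : IsPRⁿ 1 ⌊_/2⌋
pr-⌊/2⌋ = pr-rec₁ ⌊_/2⌋ (pr-∘₂ pr-∸ (pr-proj (# 1)) (pr-proj (# 0))) ⌊suc/2⌋≡∸⌊/2⌋

pr-parent : IsPRⁿ 1 parent
pr-parent = pr-ext (pr-∘₁ pr-⌊/2⌋ (pr-∘₁ pr-pred (pr-proj (# 0)))) λ { (c ∷ []) → refl }

ancestor : ℕ → ℕ → ℕ
ancestor zero    c = c
ancestor (suc i) c = parent (ancestor i c)

pr-ancestor : IsPRⁿ 2 ancestor
pr-ancestor = pr-rec₂ ancestor (pr-proj (# 0)) (pr-∘₁ pr-parent (pr-proj (# 0))) (λ _ → refl) λ _ _ → refl

ancestor-suc : ∀ i c → ancestor (suc i) c ≡ ancestor i (parent c)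
ancestor-suc zero    c = refl
ancestor-suc (suc i) c = cong parent (ancestor-suc i c)

ancestor-≤ : ∀ i c → ancestor i c ≤ c ∸ i
ancestor-≤ zero    c = ≤-refl
ancestor-≤ (suc i) c = begin
  parent (ancestor i c) ≤⟨ parent-≤ (ancestor i c) ⟩
  pred (ancestor i c)   ≤⟨ pred-mono-≤ (ancestor-≤ i c) ⟩
  pred (c ∸ i)          ≡⟨ pred[m∸n]≡m∸[1+n] c i ⟩
  c ∸ suc i             ∎
  where open ≤-Reasoning

ancestor-vanishes : ∀ i c → c ≤ i → ancestor i c ≡ 0
ancestor-vanishes i c c≤i = n≤0⇒n≡0 (≤-trans (ancestor-≤ i c) (≤-reflexive (m≤n⇒m∸n≡0 c≤i)))

sumBelow : (ℕ → ℕ) → ℕ → ℕ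
sumBelow f zero    = 0
sumBelow f (suc n) = sumBelow f n + f n

sumBelow-suc : ∀ f n → sumBelow f (suc n) ≡ f 0 + sumBelow (λ i → f (suc i)) n
sumBelow-suc f zero    = +-comm 0 (f 0)
sumBelow-suc f (suc n) = trans (cong (_+ f (suc n)) (sumBelow-suc f n)) (+-assoc (f 0) _ _)

sumBelow-cong : ∀ {f g} n → (∀ i → f i ≡ g i) → sumBelow f n ≡ sumBelow g n
sumBelow-cong zero    f≗g = refl
sumBelow-cong (suc n) f≗g = cong₂ _+_ (sumBelow-cong n f≗g) (f≗g n)

sumBelow-+ : ∀ f m k → (∀ i → m ≤ i → f i ≡ 0) → sumBelow f (m + k) ≡ sumBelow f m
sumBelow-+ f m zero    f≡0 = cong (sumBelow f) (+-identityʳ m)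
sumBelow-+ f m (suc k) f≡0 rewrite +-suc m k =
  trans (cong₂ _+_ (sumBelow-+ f m k f≡0) (f≡0 (m + k) (m≤m+n m k))) (+-identityʳ _)

sg : ℕ → ℕ
sg n = ifZero n 0 1

-- c, parent c, parent (parent c), … reach 0 within c steps, so this counts the nonempty prefixes.
depth : ℕ → ℕ
depth c = sumBelow (λ i → sg (ancestor i c)) c

pr-depth : IsPRⁿ 1 depth
pr-depth = pr-ext (pr-∘₂ pr-depthBelow (pr-proj (# 0)) (pr-proj (# 0))) λ { (c ∷ []) → refl }
  where
  pr-depthBelow : IsPRⁿ 2 (λ n c → sumBelow (λ i → sg (ancestor i c)) n)
  pr-depthBelow = pr-rec₂ _ (pr-const 0)
    (pr-∘₂ pr-+ (pr-proj (# 0)) (pr-∘₃ pr-ifZero (pr-∘₂ pr-ancestor (pr-proj (# 1)) (pr-proj (# 2))) (pr-const 0) (pr-const 1)))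
    (λ _ → refl) λ _ _ → refl

depth-child : ∀ c b → depth (child c b) ≡ suc (depth c)
depth-child c b = begin
  sumBelow (λ i → sg (ancestor i (child c b))) (child c b)
    ≡⟨ cong (sumBelow _) (child≡suc c b) ⟩
  sumBelow (λ i → sg (ancestor i (child c b))) (suc (bit b + (c + c)))
    ≡⟨ sumBelow-suc _ (bit b + (c + c)) ⟩
  sg (child c b) + sumBelow (λ i → sg (ancestor (suc i) (child c b))) (bit b + (c + c))
    ≡⟨ cong (λ n → sg n + sumBelow (λ i → sg (ancestor (suc i) (child c b))) (bit b + (c + c))) (child≡suc c b) ⟩
  1 + sumBelow (λ i → sg (ancestor (suc i) (child c b))) (bit b + (c + c))
    ≡⟨ cong suc (sumBelow-cong (bit b + (c + c)) λ i →
         cong sg (trans (ancestor-suc i (child c b)) (cong (ancestor i) (parent-child c b)))) ⟩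
  1 + sumBelow (λ i → sg (ancestor i c)) (bit b + (c + c))
    ≡⟨ cong (λ n → suc (sumBelow (λ i → sg (ancestor i c)) n)) (rearrange c (bit b)) ⟩
  1 + sumBelow (λ i → sg (ancestor i c)) (c + (c + bit b))
    ≡⟨ cong suc (sumBelow-+ _ c _ λ i c≤i → cong sg (ancestor-vanishes i c c≤i)) ⟩
  suc (depth c) ∎
  where
  open ≡-Reasoning
  rearrange : ∀ c x → x + (c + c) ≡ c + (c + x)
  rearrange = solve-∀

prefix : ℕ → ℕ → ℕ
prefix j c = ancestor (depth c ∸ j) c

pr-prefix : IsPRⁿ 2 prefix
pr-prefix = pr-ext (pr-∘₂ pr-ancestor (pr-∘₂ pr-∸ (pr-∘₁ pr-depth (pr-proj (# 1))) (pr-proj (# 0))) (pr-proj (# 1)))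
  λ { (j ∷ c ∷ []) → refl }

prefix-self : ∀ {j} c → depth c ≡ j → prefix j c ≡ c
prefix-self c refl = cong (λ i → ancestor i c) (n∸n≡0 (depth c))

prefix-child : ∀ c b {j} → j ≤ depth c → prefix j (child c b) ≡ prefix j c
prefix-child c b {j} j≤depth = begin
  ancestor (depth (child c b) ∸ j) (child c b) ≡⟨ cong (λ d → ancestor (d ∸ j) (child c b)) (depth-child c b) ⟩
  ancestor (suc (depth c) ∸ j) (child c b)     ≡⟨ cong (λ i → ancestor i (child c b)) (+-∸-assoc 1 j≤depth) ⟩
  ancestor (suc (depth c ∸ j)) (child c b)     ≡⟨ ancestor-suc (depth c ∸ j) (child c b) ⟩
  ancestor (depth c ∸ j) (parent (child c b))  ≡⟨ cong (ancestor (depth c ∸ j)) (parent-child c b) ⟩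
  ancestor (depth c ∸ j) c                     ∎
  where open ≡-Reasoning

depth-↾ : ∀ X m → depth (code (X ↾ m)) ≡ m
depth-↾ X zero    = refl
depth-↾ X (suc m) = begin
  depth (code ((X ↾ m) ++ [ X m ]))   ≡⟨ cong depth (code-snoc (X ↾ m) (X m)) ⟩
  depth (child (code (X ↾ m)) (X m))  ≡⟨ depth-child (code (X ↾ m)) (X m) ⟩
  suc (depth (code (X ↾ m)))          ≡⟨ cong suc (depth-↾ X m) ⟩
  suc m                               ∎
  where open ≡-Reasoning

prefix-↾ : ∀ X {j} m → j ≤ m → prefix j (code (X ↾ m)) ≡ code (X ↾ j)
prefix-↾ X zero z≤n = refl
prefix-↾ X {j} (suc m) j≤1+m with m≤n⇒m<n∨m≡n j≤1+m
... | inj₂ refl = prefix-self (code (X ↾ suc m)) (depth-↾ X (suc m))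
... | inj₁ j<1+m = begin
  prefix j (code ((X ↾ m) ++ [ X m ]))  ≡⟨ cong (prefix j) (code-snoc (X ↾ m) (X m)) ⟩
  prefix j (child (code (X ↾ m)) (X m)) ≡⟨ prefix-child (code (X ↾ m)) (X m) (subst (j ≤_) (sym (depth-↾ X m)) j≤m) ⟩
  prefix j (code (X ↾ m))               ≡⟨ prefix-↾ X m j≤m ⟩
  code (X ↾ j)                          ∎
  where
  open ≡-Reasoning
  j≤m : j ≤ m
  j≤m = ≤-pred j<1+m

-- Levels

n<2^n : ∀ n → n < 2 ^ n
n<2^n zero    = s≤s z≤n
n<2^n (suc n) = +-mono-<-≤ (m^n>0 2 n) (≤-trans (n<2^n n) (m≤m+n (2 ^ n) 0))

threshold : ℕ → ℕ → ℕ
threshold t e = 2 ^ suc (t + t) * e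

t<threshold : ∀ t e → t < threshold t (suc e)
t<threshold t e = begin-strict
  t                       ≤⟨ m≤m+n t t ⟩
  t + t                   <⟨ n<2^n (t + t) ⟩
  2 ^ (t + t)             ≤⟨ m≤m+n (2 ^ (t + t)) _ ⟩
  2 ^ suc (t + t)         ≤⟨ m≤m*n (2 ^ suc (t + t)) (suc e) ⟩
  threshold t (suc e)     ∎
  where open ≤-Reasoning

-- levelBelow u a e is the largest t ≤ u with a/e ≥ 2^(2t−1), or 0 if there is none.
levelBelow : ℕ → ℕ → ℕ → ℕ
levelBelow zero    a e = 0
levelBelow (suc u) a e = ifZero (threshold u e ∸ a) (suc u) (levelBelow u a e)

level : ℕ → ℕ → ℕ
level a e = levelBelow a a e

pr-level : IsPRⁿ 2 level
pr-level = pr-ext (pr-∘₃ pr-levelBelow (pr-proj (# 0)) (pr-proj (# 0)) (pr-proj (# 1))) λ { (a ∷ e ∷ []) → refl }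
  where
  pr-threshold : IsPR 4 (λ xs → threshold (lookup xs (# 1)) (lookup xs (# 3)))
  pr-threshold = pr-∘₂ pr-* (pr-∘₁ pr-2^ (pr-∘₁ pr-suc (pr-∘₂ pr-+ (pr-proj (# 1)) (pr-proj (# 1))))) (pr-proj (# 3))
  pr-levelBelow : IsPRⁿ 3 levelBelow
  pr-levelBelow = pr-rec₃ levelBelow (pr-const 0)
    (pr-∘₃ pr-ifZero (pr-∘₂ pr-∸ pr-threshold (pr-proj (# 2))) (pr-∘₁ pr-suc (pr-proj (# 1))) (pr-proj (# 0)))
    (λ _ _ → refl) λ _ _ _ → refl

levelBelow-sound : ∀ u {a e t} → levelBelow u a e ≡ suc t → threshold t e ≤ a
levelBelow-sound (suc u) {a} {e} eq with threshold u e ∸ a in thr∸a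
... | zero  = subst (λ t → threshold t e ≤ a) (suc-injective eq) (m∸n≡0⇒m≤n thr∸a)
... | suc _ = levelBelow-sound u eq

levelBelow-complete : ∀ u {a e t} → threshold t e ≤ a → t < u → suc t ≤ levelBelow u a e
levelBelow-complete (suc u) {a} {e} {t} thr≤a t<1+u with threshold u e ∸ a in thr∸a
... | zero  = t<1+u
... | suc _ with m≤n⇒m<n∨m≡n (≤-pred t<1+u)
...   | inj₁ t<u  = levelBelow-complete u thr≤a t<u
...   | inj₂ refl = contradiction (trans (sym thr∸a) (m≤n⇒m∸n≡0 thr≤a)) λ ()

level-sound : ∀ {a e t} → level a e ≡ suc t → threshold t e ≤ a
level-sound {a} = levelBelow-sound a

level-complete : ∀ {a e t} → threshold t (suc e) ≤ a → suc t ≤ level a (suc e)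
level-complete {a} {e} {t} thr≤a = levelBelow-complete a thr≤a (<-≤-trans (t<threshold t e) thr≤a)

-- The savings martingale

isAverage-scale : ∀ n n₀ n₁ H X e₀ e₁ → n * X * (e₀ * e₁ * 2) ≡ n₀ * e₁ + n₁ * e₀ →
  IsAverage n H n₀ (X * H * e₀) n₁ (X * H * e₁)
isAverage-scale n n₀ n₁ H X e₀ e₁ eq = begin
  n * (X * H * e₀ * (X * H * e₁) * 2)         ≡⟨ factor n H X e₀ e₁ ⟩
  n * X * (e₀ * e₁ * 2) * (X * H * H)         ≡⟨ cong (_* (X * H * H)) eq ⟩
  (n₀ * e₁ + n₁ * e₀) * (X * H * H)           ≡⟨ distribute n₀ n₁ H X e₀ e₁ ⟩
  (n₀ * (X * H * e₁) + n₁ * (X * H * e₀)) * H ∎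
  where
  open ≡-Reasoning
  factor : ∀ n H X e₀ e₁ → n * (X * H * e₀ * (X * H * e₁) * 2) ≡ n * X * (e₀ * e₁ * 2) * (X * H * H)
  factor = solve-∀
  distribute : ∀ n₀ n₁ H X e₀ e₁ → (n₀ * e₁ + n₁ * e₀) * (X * H * H) ≡ (n₀ * (X * H * e₁) + n₁ * (X * H * e₀)) * H
  distribute = solve-∀

savings-step-average : ∀ S P X e a e₀ a₀ e₁ a₁ → .{{_ : NonZero X}} → IsAverage a e a₀ e₀ a₁ e₁ →
  (S * e + a * P) * X * (e₀ * e₁ * 2)
    ≡ ((S * X * e + pred X * a * P) * e₀ + a₀ * (P * e)) * e₁ + ((S * X * e + pred X * a * P) * e₁ + a₁ * (P * e)) * e₀
savings-step-average S P (suc x) e a e₀ a₀ e₁ a₁ avg = begin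
  (S * e + a * P) * suc x * (e₀ * e₁ * 2)              ≡⟨ bank S P x e a e₀ e₁ ⟩
  S′ * (e₀ * e₁ * 2) + P * (a * (e₀ * e₁ * 2))         ≡⟨ cong (λ t → S′ * (e₀ * e₁ * 2) + P * t) avg ⟩
  S′ * (e₀ * e₁ * 2) + P * ((a₀ * e₁ + a₁ * e₀) * e)   ≡⟨ regroup S′ P e e₀ a₀ e₁ a₁ ⟩
  (S′ * e₀ + a₀ * (P * e)) * e₁ + (S′ * e₁ + a₁ * (P * e)) * e₀ ∎
  where
  open ≡-Reasoning
  S′ = S * suc x * e + x * a * P
  bank : ∀ S P x e a e₀ e₁ → (S * e + a * P) * suc x * (e₀ * e₁ * 2)
    ≡ (S * suc x * e + x * a * P) * (e₀ * e₁ * 2) + P * (a * (e₀ * e₁ * 2))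
  bank = solve-∀
  regroup : ∀ T P e e₀ a₀ e₁ a₁ →
    T * (e₀ * e₁ * 2) + P * ((a₀ * e₁ + a₁ * e₀) * e) ≡ (T * e₀ + a₀ * (P * e)) * e₁ + (T * e₁ + a₁ * (P * e)) * e₀
  regroup = solve-∀

-- The bank S/(2^K·P) holds at least (2^K − 1)/2.
SavingsBound : ℕ → ℕ → ℕ → Set
SavingsBound S P K = 2 ^ K * 2 ^ K * P ≤ 2 * S + 2 ^ K * P

savingsBound-step : ∀ S P K Δ a e → SavingsBound S P K → (∀ {δ} → Δ ≡ suc δ → threshold (K + δ) e ≤ a) →
  SavingsBound (S * 2 ^ Δ * e + pred (2 ^ Δ) * a * P) (P * e) (K + Δ)
savingsBound-step S P K zero a e bound _ rewrite +-identityʳ K = begin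
  2 ^ K * 2 ^ K * (P * e)           ≡⟨ *-assoc (2 ^ K * 2 ^ K) P e ⟨
  2 ^ K * 2 ^ K * P * e             ≤⟨ *-monoˡ-≤ e bound ⟩
  (2 * S + 2 ^ K * P) * e           ≡⟨ distribute S P (2 ^ K) e ⟩
  2 * (S * 1 * e + 0 * a * P) + 2 ^ K * (P * e) ∎
  where
  open ≤-Reasoning
  distribute : ∀ S P E e → (2 * S + E * P) * e ≡ 2 * (S * 1 * e + 0) + E * (P * e)
  distribute = solve-∀
-- Raising the level, the newly banked capital alone already suffices.
savingsBound-step S P K (suc δ) a e _ crossed = begin
  2 ^ (K + suc δ) * 2 ^ (K + suc δ) * (P * e)   ≡⟨ cong (λ k → 2 ^ k * 2 ^ k * (P * e)) (+-suc K δ) ⟩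
  2 ^ suc t * 2 ^ suc t * (P * e)               ≡⟨ cong (_* (P * e)) (^-distribˡ-+-* 2 (suc t) (suc t)) ⟨
  2 ^ (suc t + suc t) * (P * e)                 ≡⟨ cong (λ k → 2 ^ k * (P * e)) (+-suc (suc t) t) ⟩
  2 * 2 ^ suc (t + t) * (P * e)                 ≡⟨ reorder (2 ^ suc (t + t)) P e ⟩
  2 * (threshold t e * P)                       ≤⟨ *-monoʳ-≤ 2 (*-monoˡ-≤ P (crossed refl)) ⟩
  2 * (a * P)                                   ≤⟨ *-monoʳ-≤ 2 (*-monoˡ-≤ P a≤) ⟩
  2 * (pred (2 ^ suc δ) * a * P)                ≤⟨ *-monoʳ-≤ 2 (m≤n+m (pred (2 ^ suc δ) * a * P) (S * 2 ^ suc δ * e)) ⟩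
  2 * (S * 2 ^ suc δ * e + pred (2 ^ suc δ) * a * P) ≤⟨ m≤m+n _ (2 ^ (K + suc δ) * (P * e)) ⟩
  2 * (S * 2 ^ suc δ * e + pred (2 ^ suc δ) * a * P) + 2 ^ (K + suc δ) * (P * e) ∎
  where
  open ≤-Reasoning
  t = K + δ
  reorder : ∀ E P e → 2 * E * (P * e) ≡ 2 * (E * e * P)
  reorder = solve-∀
  a≤ : a ≤ pred (2 ^ suc δ) * a
  a≤ = ≤-trans (≤-reflexive (sym (*-identityˡ a))) (*-monoˡ-≤ a (pred-mono-≤ (*-monoʳ-≤ 2 (m^n>0 2 δ))))

savingsBound-large : ∀ S P K n → SavingsBound S P K → 2 + n ≤ K → 2 ^ n * 2 ^ K * P ≤ S
savingsBound-large S P K n bound 2+n≤K = *-cancelˡ-≤ 2 (+-cancelʳ-≤ (E * P) _ _ (begin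
  2 * (M * E * P) + E * P              ≤⟨ +-monoʳ-≤ (2 * (M * E * P)) EP≤ ⟩
  2 * (M * E * P) + 2 * (M * E * P)    ≡⟨ double M E P ⟩
  2 * (2 * M) * E * P                  ≤⟨ *-monoˡ-≤ P (*-monoˡ-≤ E (^-monoʳ-≤ 2 2+n≤K)) ⟩
  E * E * P                            ≤⟨ bound ⟩
  2 * S + E * P                        ∎))
  where
  open ≤-Reasoning
  M = 2 ^ n
  E = 2 ^ K
  double : ∀ M E P → 2 * (M * E * P) + 2 * (M * E * P) ≡ 2 * (2 * M) * E * P
  double = solve-∀
  EP≤ : E * P ≤ 2 * (M * E * P)
  EP≤ = begin
    E * P           ≤⟨ m≤n*m (E * P) M {{m^n≢0 2 n}} ⟩
    M * (E * P)     ≡⟨ *-assoc M E P ⟨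
    M * E * P       ≤⟨ m≤n*m (M * E * P) 2 ⟩
    2 * (M * E * P) ∎

-- Along the prefixes of c, d takes the values dNum j c / dDen j c. After j of them the
-- bank holds savings j c / (2^(banked j c) · denProd j c) and the stake is d/2^(banked j c);
-- raising the banked level by Δ moves a (1 − 2^−Δ) part of the stake to the bank.
module Savings (p q : ℕ → ℕ) where

  dNum dDen : ℕ → ℕ → ℕ
  dNum j c = p (prefix j c)
  dDen j c = suc (q (prefix j c))

  banked : ℕ → ℕ → ℕ
  banked zero    c = 0
  banked (suc j) c = banked j c + (level (dNum j c) (dDen j c) ∸ banked j c)

  raise : ℕ → ℕ → ℕ
  raise j c = level (dNum j c) (dDen j c) ∸ banked j c

  denProd : ℕ → ℕ → ℕ
  denProd zero    c = 1
  denProd (suc j) c = denProd j c * dDen j c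

  savings : ℕ → ℕ → ℕ
  savings zero    c = 0
  savings (suc j) c = savings j c * 2 ^ raise j c * dDen j c + pred (2 ^ raise j c) * dNum j c * denProd j c

  savingsNum savingsDen : ℕ → ℕ
  savingsNum c = savings L c * dDen L c + dNum L c * denProd L c where L = depth c
  savingsDen c = 2 ^ banked L c * denProd (suc L) c               where L = depth c

  module _ (pr-p : IsPRⁿ 1 p) (pr-q : IsPRⁿ 1 q) where
    private
      pr-atStep : ∀ {g} → IsPRⁿ 2 g → IsPR 3 (λ xs → g (lookup xs (# 1)) (lookup xs (# 2)))
      pr-atStep pr-g = pr-∘₂ pr-g (pr-proj (# 1)) (pr-proj (# 2))

      pr-dNum : IsPRⁿ 2 dNum
      pr-dNum = pr-ext (pr-∘₁ pr-p pr-prefix) λ { (j ∷ c ∷ []) → refl }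

      pr-dDen : IsPRⁿ 2 dDen
      pr-dDen = pr-ext (pr-∘₁ pr-suc (pr-∘₁ pr-q pr-prefix)) λ { (j ∷ c ∷ []) → refl }

      pr-banked : IsPRⁿ 2 banked
      pr-banked = pr-rec₂ banked (pr-const 0)
        (pr-∘₂ pr-+ (pr-proj (# 0)) (pr-∘₂ pr-∸ (pr-∘₂ pr-level (pr-atStep pr-dNum) (pr-atStep pr-dDen)) (pr-proj (# 0))))
        (λ _ → refl) λ _ _ → refl

      pr-raise : IsPRⁿ 2 raise
      pr-raise = pr-ext (pr-∘₂ pr-∸ (pr-∘₂ pr-level pr-dNum pr-dDen) pr-banked) λ { (j ∷ c ∷ []) → refl }

      pr-denProd : IsPRⁿ 2 denProd
      pr-denProd = pr-rec₂ denProd (pr-const 1) (pr-∘₂ pr-* (pr-proj (# 0)) (pr-atStep pr-dDen)) (λ _ → refl) λ _ _ → refl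

      pr-savings : IsPRⁿ 2 savings
      pr-savings = pr-rec₂ savings (pr-const 0)
        (pr-∘₂ pr-+ (pr-∘₂ pr-* (pr-∘₂ pr-* (pr-proj (# 0)) (pr-∘₁ pr-2^ (pr-atStep pr-raise))) (pr-atStep pr-dDen))
                    (pr-∘₂ pr-* (pr-∘₂ pr-* (pr-∘₁ pr-pred (pr-∘₁ pr-2^ (pr-atStep pr-raise))) (pr-atStep pr-dNum)) (pr-atStep pr-denProd)))
        (λ _ → refl) λ _ _ → refl

      pr-atDepth : ∀ {g} → IsPRⁿ 2 g → IsPR 1 (λ xs → g (depth (lookup xs (# 0))) (lookup xs (# 0)))
      pr-atDepth pr-g = pr-∘₂ pr-g (pr-∘₁ pr-depth (pr-proj (# 0))) (pr-proj (# 0))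

    pr-savingsNum : IsPRⁿ 1 savingsNum
    pr-savingsNum = pr-ext
      (pr-∘₂ pr-+ (pr-∘₂ pr-* (pr-atDepth pr-savings) (pr-atDepth pr-dDen)) (pr-∘₂ pr-* (pr-atDepth pr-dNum) (pr-atDepth pr-denProd)))
      λ { (c ∷ []) → refl }

    pr-savingsDen : IsPRⁿ 1 savingsDen
    pr-savingsDen = pr-ext
      (pr-∘₂ pr-* (pr-∘₁ pr-2^ (pr-atDepth pr-banked)) (pr-∘₂ pr-denProd (pr-∘₁ pr-suc (pr-∘₁ pr-depth (pr-proj (# 0)))) (pr-proj (# 0))))
      λ { (c ∷ []) → refl }

  module _ (c : ℕ) (b : Bool) where
    private
      c′ = child c b

    dNum-child : ∀ {j} → j ≤ depth c → dNum j c′ ≡ dNum j c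
    dNum-child j≤ = cong p (prefix-child c b j≤)

    dDen-child : ∀ {j} → j ≤ depth c → dDen j c′ ≡ dDen j c
    dDen-child j≤ = cong (λ x → suc (q x)) (prefix-child c b j≤)

    banked-child : ∀ j → j ≤ suc (depth c) → banked j c′ ≡ banked j c
    banked-child zero    _         = refl
    banked-child (suc j) (s≤s j≤) = cong₂ (λ k l → k + (l ∸ k)) (banked-child j (m≤n⇒m≤1+n j≤))
      (cong₂ level (dNum-child j≤) (dDen-child j≤))

    raise-child : ∀ {j} → j ≤ depth c → raise j c′ ≡ raise j c
    raise-child j≤ = cong₂ _∸_ (cong₂ level (dNum-child j≤) (dDen-child j≤)) (banked-child _ (m≤n⇒m≤1+n j≤))

    denProd-child : ∀ j → j ≤ suc (depth c) → denProd j c′ ≡ denProd j c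
    denProd-child zero    _         = refl
    denProd-child (suc j) (s≤s j≤) = cong₂ _*_ (denProd-child j (m≤n⇒m≤1+n j≤)) (dDen-child j≤)

    savings-child : ∀ j → j ≤ suc (depth c) → savings j c′ ≡ savings j c
    savings-child zero    _         = refl
    savings-child (suc j) (s≤s j≤) rewrite savings-child j (m≤n⇒m≤1+n j≤) | raise-child j≤ | dDen-child j≤
      | dNum-child j≤ | denProd-child j (m≤n⇒m≤1+n j≤) = refl

  savingsNum-self : ∀ {L} c → depth c ≡ L → savingsNum c ≡ savings L c * suc (q c) + p c * denProd L c
  savingsNum-self c refl =
    cong₂ (λ x y → savings (depth c) c * suc (q x) + p y * denProd (depth c) c) (prefix-self c refl) (prefix-self c refl)

  savingsDen-self : ∀ {L} c → depth c ≡ L → savingsDen c ≡ 2 ^ banked L c * (denProd L c * suc (q c))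
  savingsDen-self c refl = cong (λ x → 2 ^ banked (depth c) c * (denProd (depth c) c * suc (q x))) (prefix-self c refl)

  module _ (c : ℕ) (b : Bool) where
    private
      c′ = child c b
      L  = depth c

    savingsNum-child : savingsNum c′ ≡ savings (suc L) c * suc (q c′) + p c′ * denProd (suc L) c
    savingsNum-child = trans (savingsNum-self c′ (depth-child c b))
      (cong₂ (λ S P → S * suc (q c′) + p c′ * P) (savings-child c b (suc L) ≤-refl) (denProd-child c b (suc L) ≤-refl))

    savingsDen-child : savingsDen c′ ≡ 2 ^ raise L c * savingsDen c * suc (q c′)
    savingsDen-child = begin
      savingsDen c′
        ≡⟨ savingsDen-self c′ (depth-child c b) ⟩
      2 ^ banked (suc L) c′ * (denProd (suc L) c′ * suc (q c′))
        ≡⟨ cong₂ (λ K P → 2 ^ K * (P * suc (q c′))) (banked-child c b (suc L) ≤-refl) (denProd-child c b (suc L) ≤-refl) ⟩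
      2 ^ (banked L c + raise L c) * (denProd (suc L) c * suc (q c′))
        ≡⟨ cong (_* (denProd (suc L) c * suc (q c′))) (^-distribˡ-+-* 2 (banked L c) (raise L c)) ⟩
      2 ^ banked L c * 2 ^ raise L c * (denProd (suc L) c * suc (q c′))
        ≡⟨ reorder (2 ^ banked L c) (2 ^ raise L c) (denProd (suc L) c) (suc (q c′)) ⟩
      2 ^ raise L c * savingsDen c * suc (q c′) ∎
      where
      open ≡-Reasoning
      reorder : ∀ E X P e → E * X * (P * e) ≡ X * (E * P) * e
      reorder = solve-∀

  savings-isAverage : ∀ c →
    IsAverage (p c) (suc (q c)) (p (child c false)) (suc (q (child c false))) (p (child c true)) (suc (q (child c true))) →
    IsAverage (savingsNum c) (savingsDen c) (savingsNum (child c false)) (savingsDen (child c false))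
              (savingsNum (child c true)) (savingsDen (child c true))
  savings-isAverage c avg
    rewrite savingsNum-child c false | savingsDen-child c false | savingsNum-child c true | savingsDen-child c true =
    isAverage-scale (savingsNum c) (numAt false) (numAt true) (savingsDen c) (2 ^ raise L c) (e false) (e true)
      (savings-step-average (savings L c) (denProd L c) (2 ^ raise L c) (dDen L c) (dNum L c)
        (e false) (p (child c false)) (e true) (p (child c true)) {{m^n≢0 2 (raise L c)}} avg′)
    where
    L = depth c
    e : Bool → ℕ
    e b = suc (q (child c b))
    numAt : Bool → ℕ
    numAt b = savings (suc L) c * e b + p (child c b) * denProd (suc L) c
    avg′ : IsAverage (dNum L c) (dDen L c) (p (child c false)) (e false) (p (child c true)) (e true)
    avg′ = subst₂ (λ a d → IsAverage a d (p (child c false)) (e false) (p (child c true)) (e true))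
             (cong p (sym (prefix-self c refl))) (cong (λ x → suc (q x)) (sym (prefix-self c refl))) avg

  banked-mono : ∀ i j c → banked j c ≤ banked (i + j) c
  banked-mono zero    j c = ≤-refl
  banked-mono (suc i) j c = ≤-trans (banked-mono i j c) (m≤m+n _ _)

  raise-crossed : ∀ j c {δ} → raise j c ≡ suc δ → threshold (banked j c + δ) (dDen j c) ≤ dNum j c
  raise-crossed j c {δ} eq = level-sound (begin
    level (dNum j c) (dDen j c)                      ≡⟨ m+[n∸m]≡n K≤level ⟨
    banked j c + raise j c                          ≡⟨ cong (λ r → banked j c + r) eq ⟩
    banked j c + suc δ                              ≡⟨ +-suc (banked j c) δ ⟩
    suc (banked j c + δ)                            ∎)
    where
    open ≡-Reasoning
    K≤level : banked j c ≤ level (dNum j c) (dDen j c)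
    K≤level = <⇒≤ (m∸n≢0⇒n<m λ raise≡0 → 0≢1+n (trans (sym raise≡0) eq))

  savings-bound : ∀ j c → SavingsBound (savings j c) (denProd j c) (banked j c)
  savings-bound zero    c = ≤-refl
  savings-bound (suc j) c =
    savingsBound-step (savings j c) (denProd j c) (banked j c) (raise j c) (dNum j c) (dDen j c) (savings-bound j c) (raise-crossed j c)

  savings-success : ∀ c {m n} → m < depth c → threshold (suc n) (dDen m c) ≤ dNum m c →
                    2 ^ n * savingsDen c ≤ savingsNum c
  savings-success c {m} {n} m<L crossed = begin
    2 ^ n * (2 ^ K * (P * e))    ≡⟨ reassoc (2 ^ n) (2 ^ K) P e ⟩
    2 ^ n * 2 ^ K * P * e        ≤⟨ *-monoˡ-≤ e (savingsBound-large (savings L c) P K n (savings-bound L c) 2+n≤K) ⟩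
    savings L c * e              ≤⟨ m≤m+n _ _ ⟩
    savingsNum c                 ∎
    where
    open ≤-Reasoning
    L = depth c
    K = banked L c
    P = denProd L c
    e = dDen L c
    reassoc : ∀ M E P e → M * (E * (P * e)) ≡ M * E * P * e
    reassoc = solve-∀
    2+n≤K : 2 + n ≤ K
    2+n≤K = begin
      2 + n                             ≤⟨ level-complete crossed ⟩
      level (dNum m c) (dDen m c)       ≤⟨ m≤n+m∸n _ (banked m c) ⟩
      banked (suc m) c                  ≤⟨ banked-mono (L ∸ suc m) (suc m) c ⟩
      banked (L ∸ suc m + suc m) c      ≡⟨ cong (λ j → banked j c) (m∸n+n≡m m<L) ⟩
      K                                 ∎

  denProd-nonZero : ∀ j c → NonZero (denProd j c)
  denProd-nonZero zero    c = _
  denProd-nonZero (suc j) c = m*n≢0 (denProd j c) (dDen j c) {{denProd-nonZero j c}}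

  suc-pred-savingsDen : ∀ c → suc (pred (savingsDen c)) ≡ savingsDen c
  suc-pred-savingsDen c = suc-pred (savingsDen c)
    {{m*n≢0 (2 ^ banked L c) (denProd (suc L) c) {{m^n≢0 2 (banked L c)}} {{denProd-nonZero (suc L) c}}}}
    where L = depth c

module SavingsMartingale {d : List Bool → ℚ} (d-mart : IsMartingale d) (p q : ℕ → ℕ)
                         (d≡ : ∀ σ → d σ ≡ p (code σ) /1+ q (code σ)) where
  open Savings p q

  d′ : List Bool → ℚ
  d′ σ = savingsNum (code σ) /1+ pred (savingsDen (code σ))

  private
    d-child : ∀ σ b → d (σ ++ [ b ]) ≡ p (child (code σ) b) /1+ q (child (code σ) b)
    d-child σ b = trans (d≡ (σ ++ [ b ])) (cong (λ c → p c /1+ q c) (code-snoc σ b))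

    d′-child : ∀ σ b → d′ (σ ++ [ b ]) ≡ savingsNum (child (code σ) b) /1+ pred (savingsDen (child (code σ) b))
    d′-child σ b = cong (λ c → savingsNum c /1+ pred (savingsDen c)) (code-snoc σ b)

  d′-isMartingale : IsMartingale d′
  d′-isMartingale = nonNegative , d′-ε , d′-average
    where
    nonNegative : ∀ σ → ℚ.0ℚ ℚ.≤ d′ σ
    nonNegative σ = Equivalence.from (/1+-≤ 0 0 (savingsNum (code σ)) (pred (savingsDen (code σ)))) z≤n

    d′-ε : d′ [] ≡ ℚ.1ℚ
    d′-ε = begin
      d′ []         ≡⟨ Equivalence.from (/1+-≡ (savingsNum 0) (pred (savingsDen 0)) (p 0) (q 0)) cross ⟩
      p 0 /1+ q 0   ≡⟨ d≡ [] ⟨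
      d []          ≡⟨ proj₁ (proj₂ d-mart) ⟩
      ℚ.1ℚ          ∎
      where
      open ≡-Reasoning
      cross : p 0 * 1 * suc (q 0) ≡ p 0 * suc (pred (savingsDen 0))
      cross = cong₂ _*_ (*-identityʳ (p 0))
        (sym (trans (suc-pred-savingsDen 0) (trans (*-identityˡ _) (*-identityˡ (suc (q 0))))))

    d′-average : ∀ σ → d′ σ ≡ (d′ (σ ++ [ false ]) ℚ.+ d′ (σ ++ [ true ])) ℚ.* ½
    d′-average σ = trans
      (Equivalence.from (/1+-average (savingsNum c) (pred (savingsDen c)) (savingsNum c₀) (pred (savingsDen c₀))
                                     (savingsNum c₁) (pred (savingsDen c₁))) average)
      (sym (cong₂ (λ x y → (x ℚ.+ y) ℚ.* ½) (d′-child σ false) (d′-child σ true)))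
      where
      c = code σ
      c₀ = child c false
      c₁ = child c true
      d-average : IsAverage (p c) (suc (q c)) (p c₀) (suc (q c₀)) (p c₁) (suc (q c₁))
      d-average = Equivalence.to (/1+-average (p c) (q c) (p c₀) (q c₀) (p c₁) (q c₁)) (begin
        p c /1+ q c                                    ≡⟨ d≡ σ ⟨
        d σ                                            ≡⟨ proj₂ (proj₂ d-mart) σ ⟩
        (d (σ ++ [ false ]) ℚ.+ d (σ ++ [ true ])) ℚ.* ½
          ≡⟨ cong₂ (λ x y → (x ℚ.+ y) ℚ.* ½) (d-child σ false) (d-child σ true) ⟩
        (p c₀ /1+ q c₀ ℚ.+ p c₁ /1+ q c₁) ℚ.* ½        ∎)
        where open ≡-Reasoning
      average : IsAverage (savingsNum c) (suc (pred (savingsDen c))) (savingsNum c₀) (suc (pred (savingsDen c₀)))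
                          (savingsNum c₁) (suc (pred (savingsDen c₁)))
      average = isAverage-resp-denominators {n = savingsNum c} {n₀ = savingsNum c₀} {n₁ = savingsNum c₁}
        (suc-pred-savingsDen c) (suc-pred-savingsDen c₀) (suc-pred-savingsDen c₁) (savings-isAverage c d-average)

  d′-primRecQ : PrimRec p → PrimRec q → PrimRecQ d′
  d′-primRecQ pr-p pr-q = savingsNum , (λ c → pred (savingsDen c)) ,
    isPR⇒primRec (pr-savingsNum (primRec⇒isPR pr-p) (primRec⇒isPR pr-q)) ,
    isPR⇒primRec (pr-ext (pr-∘₁ pr-pred (pr-savingsDen (primRec⇒isPR pr-p) (primRec⇒isPR pr-q))) λ { (c ∷ []) → refl }) ,
    λ σ → refl

  d′-success : ∀ X {m m′} n → m < m′ → pow2 (suc (suc n + suc n)) ℚ.≤ d (X ↾ m) → pow2 n ℚ.≤ d′ (X ↾ m′)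
  d′-success X {m} {m′} n m<m′ d≥ = Equivalence.from (/1+-≤ (2 ^ n) 0 (savingsNum c) (pred (savingsDen c))) (begin
    2 ^ n * suc (pred (savingsDen c)) ≡⟨ cong (2 ^ n *_) (suc-pred-savingsDen c) ⟩
    2 ^ n * savingsDen c              ≤⟨ savings-success c {m} {n} (subst (m <_) (sym (depth-↾ X m′)) m<m′) crossed ⟩
    savingsNum c                      ≡⟨ *-identityʳ (savingsNum c) ⟨
    savingsNum c * 1                  ∎)
    where
    open ≤-Reasoning
    c = code (X ↾ m′)
    crossed : threshold (suc n) (dDen m c) ≤ dNum m c
    crossed rewrite prefix-↾ X m′ (<⇒≤ m<m′) =
      subst (threshold (suc n) (suc (q cₘ)) ≤_) (*-identityʳ (p cₘ))
        (Equivalence.to (/1+-≤ (2 ^ suc (suc n + suc n)) 0 (p cₘ) (q cₘ)) (subst (pow2 (suc (suc n + suc n)) ℚ.≤_) (d≡ (X ↾ m)) d≥))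
      where cₘ = code (X ↾ m)

Witness : ((List Bool → ℚ) → (ℕ → ℕ) → Set) → Set
Witness succeeds = Σ (List Bool → ℚ) λ d → Σ (ℕ → ℕ) λ f → PRMartingale d × PrimRec f × succeeds d f

SucceedsAt SucceedsWithin SucceedsFrom : Seq → (List Bool → ℚ) → (ℕ → ℕ) → Set
SucceedsAt     X d f = ∀ n → pow2 n ℚ.≤ d (X ↾ f n)
SucceedsWithin X d f = ∀ n → Σ ℕ λ m → m ≤ f n × pow2 n ℚ.≤ d (X ↾ m)
SucceedsFrom   X d f = ∀ n m → f n ≤ m → pow2 n ℚ.≤ d (X ↾ m)

module _ (X : Seq) where

  from⇒at : Witness (SucceedsFrom X) → Witness (SucceedsAt X)
  from⇒at (d , f , d-pr , f-pr , from) = d , f , d-pr , f-pr , λ n → from n (f n) ≤-refl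

  at⇒within : Witness (SucceedsAt X) → Witness (SucceedsWithin X)
  at⇒within (d , f , d-pr , f-pr , at) = d , f , d-pr , f-pr , λ n → f n , ≤-refl , at n

  within⇒from : Witness (SucceedsWithin X) → Witness (SucceedsFrom X)
  within⇒from (d , f , (d-mart , p , q , p-pr , q-pr , d≡) , f-pr , within) =
    d′ , f′ , (d′-isMartingale , d′-primRecQ p-pr q-pr) , f′-pr , from
    where
    open SavingsMartingale d-mart p q d≡
    -- d ≥ 2^(2n+3) = 2^(2(n+2)−1) means level n + 2.
    f′ : ℕ → ℕ
    f′ n = suc (f (suc (suc n + suc n)))
    f′-pr : PrimRec f′
    f′-pr = isPR⇒primRec (pr-ext
      (pr-∘₁ pr-suc (pr-∘₁ (primRec⇒isPR f-pr) (pr-∘₁ pr-suc (pr-∘₂ pr-+ (pr-∘₁ pr-suc (pr-proj (# 0))) (pr-∘₁ pr-suc (pr-proj (# 0)))))))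
      λ { (n ∷ []) → refl })
    from : SucceedsFrom X d′ f′
    from n m′ f′n≤m′ with within (suc (suc n + suc n))
    ... | m , m≤f , d≥ = d′-success X n (≤-trans (s≤s m≤f) f′n≤m′) d≥

proposition2p3 : (X : Seq) →
    (MartingaleBPRandom X ⇔ Cond2 X) × (MartingaleBPRandom X ⇔ Cond3 X)
proposition2p3 X =
  mk⇔ (λ random within → random (from⇒at X (within⇒from X within))) (λ ¬within at → ¬within (at⇒within X at)) ,
  mk⇔ (λ random from → random (from⇒at X from)) (λ ¬from at → ¬from (within⇒from X (at⇒within X at)))
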